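{- Let $\mathfrak{F}=\langle W,R\rangle$ be an $\mathbf{S4}$ frame. If $\mathfrak{F}$ satisfies $(su_2)$, then $\mathfrak{F}$ satisfies $(su_n)$ for every integer $n\ge2$.
   Context: An $\mathbf{S4}$ frame is a set $W$ with a reflexive transitive relation $R$. For $X\subseteq W$: $\mathord{\uparrow}X=\{w:\exists x\in X,\ xRw\}$, $\Diamond X=\{w:\exists x\in X,\ wRx\}$, $\Box X=\{w:\forall v(wRv\Rightarrow v\in X)\}$. For $k\ge1$, $z$ strongly unites $y_0,\dots,y_{k-1}$ if for every $i<k$: $zRy_i$ and $z\in\Box\big(\mathord{\uparrow}\{y_i\}\cup\bigcup_{i'\in k\setminus\{i\}}\Diamond\mathord{\uparrow}\{y_{i'}\}\big)$. $\mathfrak{F}$ satisfies $(su_k)$ if for every $w\in W$ and all $y_0,\dots,y_{k-1}$ with $wRy_i$ for all $i$, there is $z$ with $wRz$ strongly uniting $y_0,\dots,y_{k-1}$. -}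

module Defs where

open import Level using (Level; _⊔_; suc)
open import Data.Nat using (ℕ; _≥_)
open import Data.Fin using (Fin)
open import Data.Product using (Σ; _×_; ∃-syntax)
open import Data.Sum using (_⊎_)
open import Relation.Nullary using (¬_)
open import Relation.Binary.PropositionalEquality using (_≡_)

record S4Frame (a ℓ : Level) : Set (Level.suc (a ⊔ ℓ)) where
  field
    W     : Set a
    R     : W → W → Set ℓ
    refl  : ∀ w → R w w
    trans : ∀ {u v w} → R u v → R v w → R u w

module _ {a ℓ : Level} (F : S4Frame a ℓ) where
  open S4Frame F

  Subset : Set (Level.suc (a ⊔ ℓ))
  Subset = W → Set (a ⊔ ℓ)

  up : Subset → Subset
  up X w = ∃[ x ] (X x × R x w)

  dia : Subset → Subset
  dia X w = ∃[ x ] (X x × R w x)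

  box : Subset → Subset
  box X w = ∀ v → R w v → X v

  sing : W → Subset
  sing y w = Level.Lift (a ⊔ ℓ) (y ≡ w)

  _∪_ : Subset → Subset → Subset
  (X ∪ Y) w = X w ⊎ Y w

  ⋃except : {k : ℕ} → Fin k → (Fin k → Subset) → Subset
  ⋃except i X w = ∃[ i' ] (¬ (i' ≡ i) × X i' w)

  StronglyUnites : {k : ℕ} → W → (Fin k → W) → Set (a ⊔ ℓ)
  StronglyUnites {k} z y =
    ∀ (i : Fin k) →
      R z (y i) ×
      box (up (sing (y i)) ∪ ⋃except i (λ i' → dia (up (sing (y i'))))) z

  su : ℕ → Set (a ⊔ ℓ)
  su k = ∀ (w : W) (y : Fin k → W) → (∀ i → R w (y i)) →
         ∃[ z ] (R w z × StronglyUnites z y)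

{-# OPTIONS --safe #-}
module Submission where

open import Defs
open import Level using (Level; lift)
open import Data.Nat using (ℕ; _≥_; zero; suc; s≤s; z≤n)
open import Data.Fin using (Fin; zero; suc)
open import Data.Fin.Properties using (0≢1+n; suc-injective)
open import Data.Vec.Functional using (Vector; _∷_; []; head; tail)
open import Data.Product using (_,_; proj₁; proj₂; ∃-syntax)
open import Data.Sum using (inj₁; inj₂)
open import Function using (_∘_)
open import Relation.Nullary using (contradiction)
open import Relation.Binary.PropositionalEquality using (refl; sym)

-- Given y₀,…,yₙ above w, let z' strongly unite y₁,…,yₙ and
-- let z strongly unite the pair (z', y₀), both above w. Then z strongly unites
-- y₀,…,yₙ: everything above z' lies in some ◇↑{yⱼ} with j ≥ 1, because z'
-- strongly unites y₁,…,yₙ, so ◇↑{z'} is covered by these sets as well.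

module _ {a ℓ : Level} (F : S4Frame a ℓ) where
  open S4Frame F renaming (refl to R-refl; trans to R-trans)

  Near : W → Subset F
  Near y = dia F (up F (sing F y))

  Fan : ∀ {k} → Vector W k → Fin k → Subset F
  Fan y i = _∪_ F (up F (sing F (y i))) (⋃except F i (Near ∘ y))

  up-sing⇒R : ∀ {y v} → up F (sing F y) v → R y v
  up-sing⇒R (_ , lift refl , yRv) = yRv

  up⇒dia-up : ∀ {X v} → up F X v → dia F (up F X) v
  up⇒dia-up {v = v} p = v , p , R-refl v

  dia-downClosed : ∀ {X v x} → R v x → dia F X x → dia F X v
  dia-downClosed vRx (u , p , xRu) = u , p , R-trans vRx xRu

  ⋃except-suc : ∀ {k} {i : Fin k} {X : Fin (suc k) → Subset F} {v} →
                ⋃except F i (X ∘ suc) v → ⋃except F (suc i) X v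
  ⋃except-suc (j , j≢i , p) = suc j , j≢i ∘ suc-injective , p

  ⋃except-pair-zero : ∀ {X : Fin 2 → Subset F} {v} →
                      ⋃except F zero X v → X (suc zero) v
  ⋃except-pair-zero (zero , 0≢0 , _) = contradiction refl 0≢0
  ⋃except-pair-zero (suc zero , _ , p) = p

  ⋃except-pair-one : ∀ {X : Fin 2 → Subset F} {v} →
                     ⋃except F (suc zero) X v → X zero v
  ⋃except-pair-one (zero , _ , p) = p
  ⋃except-pair-one (suc zero , 1≢1 , _) = contradiction refl 1≢1

  up-unifier⊆⋃Near : ∀ {m z x} {y : Vector W (suc m)} →
                       StronglyUnites F z y → R z x → ∃[ j ] Near (y j) x
  up-unifier⊆⋃Near z-unites zRx with proj₂ (z-unites zero) _ zRx
  ... | inj₁ y₀Rx = zero , up⇒dia-up y₀Rx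
  ... | inj₂ (j , _ , near) = j , near

  Near-unifier⊆⋃Near : ∀ {m z v} {y : Vector W (suc m)} →
                      StronglyUnites F z y → Near z v → ∃[ j ] Near (y j) v
  Near-unifier⊆⋃Near z-unites (x , z↑x , vRx)
    with up-unifier⊆⋃Near z-unites (up-sing⇒R z↑x)
  ... | j , near = j , dia-downClosed vRx near

  StronglyUnites-cons : ∀ {m z z'} (y : Vector W (suc (suc m))) →
                        StronglyUnites F z' (tail y) →
                        StronglyUnites F z (z' ∷ head y ∷ []) →
                        StronglyUnites F z y
  StronglyUnites-cons {z = z} {z'} y z'-unites z-unites zero =
    proj₁ (z-unites (suc zero)) , fan₀
    where
      fan₀ : box F (Fan y zero) z
      fan₀ v zRv with proj₂ (z-unites (suc zero)) v zRv
      ... | inj₁ y₀↑v = inj₁ y₀↑v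
      ... | inj₂ near-z'
        with Near-unifier⊆⋃Near z'-unites (⋃except-pair-one {X = Near ∘ (z' ∷ head y ∷ [])} near-z')
      ...   | j , near = inj₂ (suc j , 0≢1+n ∘ sym , near)
  StronglyUnites-cons {z = z} {z'} y z'-unites z-unites (suc i) =
    R-trans (proj₁ (z-unites zero)) (proj₁ (z'-unites i)) , fanₛ
    where
      fanₛ : box F (Fan y (suc i)) z
      fanₛ v zRv with proj₂ (z-unites zero) v zRv
      ... | inj₂ near-y₀ =
        inj₂ (zero , 0≢1+n , ⋃except-pair-zero {X = Near ∘ (z' ∷ head y ∷ [])} near-y₀)
      ... | inj₁ z'↑v with proj₂ (z'-unites i) v (up-sing⇒R z'↑v)
      ...   | inj₁ yᵢ↑v = inj₁ yᵢ↑v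
      ...   | inj₂ near = inj₂ (⋃except-suc {X = Near ∘ y} near)

  su-suc : ∀ {m} → su F 2 → su F (suc (suc m)) → su F (suc (suc (suc m)))
  su-suc su₂ suₘ w y wRy =
    let z' , wRz' , z'-unites = suₘ w (tail y) (wRy ∘ suc)
        z , wRz , z-unites = su₂ w (z' ∷ head y ∷ [])
                               λ { zero → wRz' ; (suc zero) → wRy zero }
    in z , wRz , StronglyUnites-cons y z'-unites z-unites

  su₂⇒su-2+ : su F 2 → ∀ m → su F (suc (suc m))
  su₂⇒su-2+ su₂ zero = su₂
  su₂⇒su-2+ su₂ (suc m) = su-suc su₂ (su₂⇒su-2+ su₂ m)

lemma4 : {a ℓ : Level} (F : S4Frame a ℓ) →
    su F 2 → (n : ℕ) → n ≥ 2 → su F n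
lemma4 F su₂ (suc (suc m)) (s≤s (s≤s z≤n)) = su₂⇒su-2+ F su₂ m
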